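{- Let $\mathfrak g$ be a finite-dimensional real nilpotent Lie algebra with filtration $\mathfrak g_\bullet$ of step $s$. Suppose that the sequence of subspaces $(S_i)_{i=1}^s$ with $S_i\le\mathfrak g_i$ satisfies $S_i+\mathfrak h_i=\mathfrak g_i$ for all $i$. Then the sequence of subspaces $(W_i)_{i=1}^s$ satisfies $W_i+\mathfrak g_{i+1}=\mathfrak g_i$ for all $i$.
   Context: Filtration of step $s$: Lie subalgebras $\mathfrak g=\mathfrak g_0=\mathfrak g_1\ge\dots\ge\mathfrak g_s$ with $[\mathfrak g_i,\mathfrak g_j]\le\mathfrak g_{i+j}$ and $\mathfrak g_k=0$ for $k>s$. $\mathfrak h_i$ is the smallest Lie subalgebra of $\mathfrak g$ containing $\mathfrak g_{i+1}$ and $[\mathfrak g_j,\mathfrak g_{i-j}]$ for all $0\le j\le i$. $W_1=S_1$ and for $i=2,\dots,s$, $W_i=\mathrm{span}\big(S_i\cup\bigcup_{j=1}^{i-1}[W_j,W_{i-j}]\big)$. -}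

module Defs where

open import Level using (0ℓ)
open import Data.Nat using (ℕ; zero; suc; _+_; _∸_; _≤_; _<_)
open import Data.List using (List)
open import Data.List.Membership.Propositional using (_∈_)
open import Data.Product using (Σ; ∃; _×_; _,_)
open import Data.Sum using (_⊎_)
open import Relation.Nullary using (¬_)
open import Relation.Unary using (Pred; _⊆_)
open import Relation.Binary.PropositionalEquality using (_≡_)

-- The real numbers, axiomatised as a (Dedekind-)complete ordered field.
-- (All such structures are isomorphic to ℝ; agda-stdlib has no ℝ.)

record CompleteOrderedField : Set₁ where
  infixl 6 _+ᵣ_
  infixl 7 _*ᵣ_
  infix  4 _≤ᵣ_
  field
    ℝ     : Set
    0r 1r : ℝ
    _+ᵣ_ _*ᵣ_ : ℝ → ℝ → ℝ
    -_    : ℝ → ℝ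
    _≤ᵣ_   : ℝ → ℝ → Set
    +-assoc : ∀ x y z → (x +ᵣ y) +ᵣ z ≡ x +ᵣ (y +ᵣ z)
    +-comm  : ∀ x y → x +ᵣ y ≡ y +ᵣ x
    +-idʳ   : ∀ x → x +ᵣ 0r ≡ x
    +-invʳ  : ∀ x → x +ᵣ (- x) ≡ 0r
    *-assoc : ∀ x y z → (x *ᵣ y) *ᵣ z ≡ x *ᵣ (y *ᵣ z)
    *-comm  : ∀ x y → x *ᵣ y ≡ y *ᵣ x
    *-idʳ   : ∀ x → x *ᵣ 1r ≡ x
    distribʳ : ∀ x y z → x *ᵣ (y +ᵣ z) ≡ x *ᵣ y +ᵣ x *ᵣ z
    0≢1     : ¬ (0r ≡ 1r)
    *-inv   : ∀ x → ¬ (x ≡ 0r) → ∃ λ y → x *ᵣ y ≡ 1r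
    ≤-refl    : ∀ x → x ≤ᵣ x
    ≤-antisym : ∀ {x y} → x ≤ᵣ y → y ≤ᵣ x → x ≡ y
    ≤-trans   : ∀ {x y z} → x ≤ᵣ y → y ≤ᵣ z → x ≤ᵣ z
    ≤-total   : ∀ x y → x ≤ᵣ y ⊎ y ≤ᵣ x
    +-mono    : ∀ {x y} z → x ≤ᵣ y → x +ᵣ z ≤ᵣ y +ᵣ z
    *-nonneg  : ∀ {x y} → 0r ≤ᵣ x → 0r ≤ᵣ y → 0r ≤ᵣ x *ᵣ y
    sup : (P : Pred ℝ 0ℓ) → (∃ λ x → P x) → (∃ λ b → ∀ x → P x → x ≤ᵣ b) →
          ∃ λ m → (∀ x → P x → x ≤ᵣ m) × (∀ b → (∀ x → P x → x ≤ᵣ b) → m ≤ᵣ b)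

record LieAlgebra (R : CompleteOrderedField) : Set₁ where
  open CompleteOrderedField R using (ℝ; 0r; 1r) renaming (_+ᵣ_ to _+r_; _*ᵣ_ to _*r_)
  infixl 6 _⊕_
  infixr 7 _·_
  field
    V    : Set
    𝟎    : V
    _⊕_  : V → V → V
    ⊖_   : V → V
    _·_  : ℝ → V → V
    ⁅_,_⁆ : V → V → V
    ⊕-assoc : ∀ x y z → (x ⊕ y) ⊕ z ≡ x ⊕ (y ⊕ z)
    ⊕-comm  : ∀ x y → x ⊕ y ≡ y ⊕ x
    ⊕-idʳ   : ∀ x → x ⊕ 𝟎 ≡ x
    ⊕-invʳ  : ∀ x → x ⊕ (⊖ x) ≡ 𝟎
    ·-distribᵛ : ∀ a x y → a · (x ⊕ y) ≡ a · x ⊕ a · y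
    ·-distribˢ : ∀ a b x → (a +r b) · x ≡ a · x ⊕ b · x
    ·-assoc    : ∀ a b x → (a *r b) · x ≡ a · (b · x)
    ·-id       : ∀ x → 1r · x ≡ x
    br-addˡ : ∀ x y z → ⁅ x ⊕ y , z ⁆ ≡ ⁅ x , z ⁆ ⊕ ⁅ y , z ⁆
    br-addʳ : ∀ x y z → ⁅ x , y ⊕ z ⁆ ≡ ⁅ x , y ⁆ ⊕ ⁅ x , z ⁆
    br-scaˡ : ∀ a x y → ⁅ a · x , y ⁆ ≡ a · ⁅ x , y ⁆
    br-scaʳ : ∀ a x y → ⁅ x , a · y ⁆ ≡ a · ⁅ x , y ⁆
    br-alt  : ∀ x → ⁅ x , x ⁆ ≡ 𝟎
    jacobi  : ∀ x y z → ⁅ x , ⁅ y , z ⁆ ⁆ ⊕ ⁅ y , ⁅ z , x ⁆ ⁆ ⊕ ⁅ z , ⁅ x , y ⁆ ⁆ ≡ 𝟎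

module LieTheory {R : CompleteOrderedField} (L : LieAlgebra R) where
  open CompleteOrderedField R using (ℝ)
  open LieAlgebra L

  Sub : Set₁
  Sub = Pred V 0ℓ

  record IsSubspace (U : Sub) : Set where
    field
      has-𝟎 : U 𝟎
      has-⊕ : ∀ {x y} → U x → U y → U (x ⊕ y)
      has-· : ∀ a {x} → U x → U (a · x)

  record IsLieSubalgebra (U : Sub) : Set where
    field
      subspace : IsSubspace U
      has-br   : ∀ {x y} → U x → U y → U ⁅ x , y ⁆

  data Span (X : Sub) : Sub where
    gen  : ∀ {x} → X x → Span X x
    zer  : Span X 𝟎
    add  : ∀ {x y} → Span X x → Span X y → Span X (x ⊕ y)
    sca  : ∀ a {x} → Span X x → Span X (a · x)

  data Brackets (A B : Sub) : Sub where
    mk : ∀ {a b} → A a → B b → Brackets A B ⁅ a , b ⁆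

  BrSpan : Sub → Sub → Sub
  BrSpan A B = Span (Brackets A B)

  data GenLie (X : Sub) : Sub where
    gen  : ∀ {x} → X x → GenLie X x
    zer  : GenLie X 𝟎
    add  : ∀ {x y} → GenLie X x → GenLie X y → GenLie X (x ⊕ y)
    sca  : ∀ a {x} → GenLie X x → GenLie X (a · x)
    brk  : ∀ {x y} → GenLie X x → GenLie X y → GenLie X ⁅ x , y ⁆

  SumIs : Sub → Sub → Sub → Set
  SumIs A B C = ∀ v → (C v → ∃ λ a → ∃ λ b → A a × B b × v ≡ a ⊕ b)
                    × (∀ {a b} → A a → B b → C (a ⊕ b))

  FiniteDimensional : Set
  FiniteDimensional = ∃ λ (L : List V) → ∀ v → Span (λ x → x ∈ L) v

  LCS : ℕ → Sub
  LCS zero    = λ _ → Data.Unit.⊤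
    where import Data.Unit
  LCS (suc k) = BrSpan (λ _ → Data.Unit.⊤) (LCS k)
    where import Data.Unit

  Nilpotent : Set
  Nilpotent = ∃ λ n → ∀ v → LCS n v → v ≡ 𝟎

  record IsFiltration (s : ℕ) (g : ℕ → Sub) : Set where
    field
      g0-all   : ∀ v → g 0 v
      g1-all   : ∀ v → g 1 v
      lieSub   : ∀ i → IsLieSubalgebra (g i)
      decr     : ∀ i → g (suc i) ⊆ g i
      bracket  : ∀ i j {x y} → g i x → g j y → g (i + j) ⁅ x , y ⁆
      vanish   : ∀ k → s < k → ∀ v → g k v → v ≡ 𝟎

  data HGen (g : ℕ → Sub) (i : ℕ) : Sub where
    next : ∀ {x} → g (suc i) x → HGen g i x
    brs  : ∀ j {x} → j ≤ i → BrSpan (g j) (g (i ∸ j)) x → HGen g i x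

  𝔥 : (ℕ → Sub) → ℕ → Sub
  𝔥 g i = GenLie (HGen g i)

  data W (S : ℕ → Sub) : ℕ → Sub where
    fromS : ∀ {i x} → S i x → W S i x
    brW   : ∀ {i} j {x} → 1 ≤ j → j < i → BrSpan (W S j) (W S (i ∸ j)) x → W S i x
    zer   : ∀ {i} → W S i 𝟎
    add   : ∀ {i x y} → W S i x → W S i y → W S i (x ⊕ y)
    sca   : ∀ {i} a {x} → W S i x → W S i (a · x)

{-# OPTIONS --safe #-}
-- Set Tᵢ = Wᵢ + 𝔤ᵢ₊₁, a subspace of 𝔤ᵢ, and show 𝔤ᵢ ⊆ Tᵢ by strong induction on i. Since
-- 𝔤ᵢ = Sᵢ + 𝔥ᵢ and Sᵢ ⊆ Wᵢ, it suffices that 𝔥ᵢ ⊆ Tᵢ. Brackets of two elements of 𝔥ᵢ ⊆ 𝔤ᵢ lie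
-- in 𝔤₂ᵢ ⊆ 𝔤ᵢ₊₁, so only the generators of 𝔥ᵢ matter: 𝔤ᵢ₊₁, [𝔤₀, 𝔤ᵢ] and [𝔤ᵢ, 𝔤₀] lie in 𝔤ᵢ₊₁
-- because 𝔤₀ = 𝔤₁, and for 0 < j < i the induction hypothesis splits a ∈ 𝔤ⱼ and b ∈ 𝔤ᵢ₋ⱼ
-- as w + r and w' + r', whence [a, b] = [w, w'] + [w, r'] + [r, b] ∈ Wᵢ + 𝔤ᵢ₊₁.
module Submission where

open import Defs
open import Data.Nat using (ℕ; zero; suc; _+_; _∸_; _≤_; _<_; _≤′_; ≤′-refl; ≤′-step; _≟_; s≤s; z≤n)
open import Data.Nat.Properties
  using (≤-trans; ≤-reflexive; +-comm; +-monoʳ-≤; <⇒≤; ≤⇒≤′; +-suc; m≤n+m∸n; m∸n≤m; m<n⇒0<n∸m; ∸-monoʳ-<; ≤∧≢⇒<)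
open import Data.Nat.Induction using (<-rec)
open import Data.Product using (_×_; _,_; proj₁; proj₂; ∃)
open import Function using (_∘_)
open import Relation.Nullary using (yes; no)
open import Relation.Unary using (_⊆_)
open import Relation.Binary.PropositionalEquality using (_≡_; refl; sym; trans; cong; module ≡-Reasoning)

module LieAlgebraFacts {R : CompleteOrderedField} (L : LieAlgebra R) where
  open LieAlgebra L
  open LieTheory L
  open IsSubspace

  ⊕-identityˡ : ∀ x → 𝟎 ⊕ x ≡ x
  ⊕-identityˡ x = trans (⊕-comm 𝟎 x) (⊕-idʳ x)

  ⊕-interchange : ∀ w x y z → (w ⊕ x) ⊕ (y ⊕ z) ≡ (w ⊕ y) ⊕ (x ⊕ z)
  ⊕-interchange w x y z = begin
    (w ⊕ x) ⊕ (y ⊕ z) ≡⟨ ⊕-assoc w x (y ⊕ z) ⟩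
    w ⊕ (x ⊕ (y ⊕ z)) ≡⟨ cong (w ⊕_) (sym (⊕-assoc x y z)) ⟩
    w ⊕ ((x ⊕ y) ⊕ z) ≡⟨ cong (λ t → w ⊕ (t ⊕ z)) (⊕-comm x y) ⟩
    w ⊕ ((y ⊕ x) ⊕ z) ≡⟨ cong (w ⊕_) (⊕-assoc y x z) ⟩
    w ⊕ (y ⊕ (x ⊕ z)) ≡⟨ sym (⊕-assoc w y (x ⊕ z)) ⟩
    (w ⊕ y) ⊕ (x ⊕ z) ∎
    where open ≡-Reasoning

  br-⊕-expand : ∀ w r w' r' → ⁅ w ⊕ r , w' ⊕ r' ⁆ ≡ ⁅ w , w' ⁆ ⊕ (⁅ w , r' ⁆ ⊕ ⁅ r , w' ⊕ r' ⁆)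
  br-⊕-expand w r w' r' = begin
    ⁅ w ⊕ r , w' ⊕ r' ⁆                          ≡⟨ br-addˡ w r (w' ⊕ r') ⟩
    ⁅ w , w' ⊕ r' ⁆ ⊕ ⁅ r , w' ⊕ r' ⁆             ≡⟨ cong (_⊕ ⁅ r , w' ⊕ r' ⁆) (br-addʳ w w' r') ⟩
    (⁅ w , w' ⁆ ⊕ ⁅ w , r' ⁆) ⊕ ⁅ r , w' ⊕ r' ⁆   ≡⟨ ⊕-assoc ⁅ w , w' ⁆ ⁅ w , r' ⁆ ⁅ r , w' ⊕ r' ⁆ ⟩
    ⁅ w , w' ⁆ ⊕ (⁅ w , r' ⁆ ⊕ ⁅ r , w' ⊕ r' ⁆) ∎
    where open ≡-Reasoning

  Span-least : ∀ {X P : Sub} → IsSubspace P → X ⊆ P → Span X ⊆ P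
  Span-least P X⊆P (gen x)   = X⊆P x
  Span-least P X⊆P zer       = has-𝟎 P
  Span-least P X⊆P (add x y) = has-⊕ P (Span-least P X⊆P x) (Span-least P X⊆P y)
  Span-least P X⊆P (sca a x) = has-· P a (Span-least P X⊆P x)

  GenLie-least : ∀ {X Q : Sub} → IsLieSubalgebra Q → X ⊆ Q → GenLie X ⊆ Q
  GenLie-least Q X⊆Q (gen x)   = X⊆Q x
  GenLie-least Q X⊆Q zer       = has-𝟎 (IsLieSubalgebra.subspace Q)
  GenLie-least Q X⊆Q (add x y) = has-⊕ (IsLieSubalgebra.subspace Q) (GenLie-least Q X⊆Q x) (GenLie-least Q X⊆Q y)
  GenLie-least Q X⊆Q (sca a x) = has-· (IsLieSubalgebra.subspace Q) a (GenLie-least Q X⊆Q x)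
  GenLie-least Q X⊆Q (brk x y) = IsLieSubalgebra.has-br Q (GenLie-least Q X⊆Q x) (GenLie-least Q X⊆Q y)

  GenLie-⊆-subspace : ∀ {X P Q : Sub} → IsSubspace P → IsLieSubalgebra Q → X ⊆ P → X ⊆ Q →
                      (∀ {x y} → Q x → Q y → P ⁅ x , y ⁆) → GenLie X ⊆ P
  GenLie-⊆-subspace P Q X⊆P X⊆Q [Q,Q]⊆P = go
    where
      go : GenLie _ ⊆ _
      go (gen x)   = X⊆P x
      go zer       = has-𝟎 P
      go (add x y) = has-⊕ P (go x) (go y)
      go (sca a x) = has-· P a (go x)
      go (brk x y) = [Q,Q]⊆P (GenLie-least Q X⊆Q x) (GenLie-least Q X⊆Q y)

  infixl 6 _+ˢ_
  _+ˢ_ : Sub → Sub → Sub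
  (A +ˢ B) v = ∃ λ a → ∃ λ b → A a × B b × v ≡ a ⊕ b

  +ˢ-isSubspace : ∀ {A B} → IsSubspace A → IsSubspace B → IsSubspace (A +ˢ B)
  +ˢ-isSubspace A B = record
    { has-𝟎 = 𝟎 , 𝟎 , has-𝟎 A , has-𝟎 B , sym (⊕-idʳ 𝟎)
    ; has-⊕ = λ { (a , b , Aa , Bb , refl) (a' , b' , Aa' , Bb' , refl) →
                  a ⊕ a' , b ⊕ b' , has-⊕ A Aa Aa' , has-⊕ B Bb Bb' , ⊕-interchange a b a' b' }
    ; has-· = λ { c (a , b , Aa , Bb , refl) → c · a , c · b , has-· A c Aa , has-· B c Bb , ·-distribᵛ c a b }
    }

  +ˢ-inj₁ : ∀ {A B} → IsSubspace B → A ⊆ A +ˢ B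
  +ˢ-inj₁ B {x} Ax = x , 𝟎 , Ax , has-𝟎 B , sym (⊕-idʳ x)

  +ˢ-inj₂ : ∀ {A B} → IsSubspace A → B ⊆ A +ˢ B
  +ˢ-inj₂ A {x} Bx = 𝟎 , x , has-𝟎 A , Bx , sym (⊕-identityˡ x)

module Filtered {R : CompleteOrderedField} (L : LieAlgebra R) {s : ℕ} {g : ℕ → LieTheory.Sub L}
                (F : LieTheory.IsFiltration L s g) where
  open LieAlgebra L
  open LieTheory L
  open IsFiltration F
  open LieAlgebraFacts L

  g-isSubspace : ∀ i → IsSubspace (g i)
  g-isSubspace i = IsLieSubalgebra.subspace (lieSub i)

  g-antitone : ∀ {m n} → m ≤ n → g n ⊆ g m
  g-antitone = go ∘ ≤⇒≤′
    where
      go : ∀ {m n} → m ≤′ n → g n ⊆ g m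
      go ≤′-refl      = λ x → x
      go (≤′-step m≤n) = go m≤n ∘ decr _

  bracket-≤ : ∀ {i j k x y} → k ≤ i + j → g i x → g j y → g k ⁅ x , y ⁆
  bracket-≤ {i} {j} k≤i+j x y = g-antitone k≤i+j (bracket i j x y)

  HGen⊆g : ∀ i → HGen g i ⊆ g i
  HGen⊆g i (next x)     = decr i x
  HGen⊆g i (brs j _ xs) = Span-least (g-isSubspace i) (λ { (mk x y) → bracket-≤ (m≤n+m∸n i j) x y }) xs

module Complemented {R : CompleteOrderedField} (L : LieAlgebra R) {s : ℕ} {g : ℕ → LieTheory.Sub L}
                    (F : LieTheory.IsFiltration L s g) {S : ℕ → LieTheory.Sub L}
                    (S⊆g : ∀ i → 1 ≤ i → i ≤ s → S i ⊆ g i) where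
  open LieAlgebra L
  open LieTheory L
  open IsFiltration F
  open IsSubspace
  open LieAlgebraFacts L
  open Filtered L F

  W-isSubspace : ∀ i → IsSubspace (W S i)
  W-isSubspace i = record { has-𝟎 = zer ; has-⊕ = add ; has-· = sca }

  W⊆g : ∀ i → 1 ≤ i → i ≤ s → W S i ⊆ g i
  BrSpanW⊆g : ∀ i j → 1 ≤ j → j < i → i ≤ s → BrSpan (W S j) (W S (i ∸ j)) ⊆ g i
  W⊆g i 1≤i i≤s (fromS x)           = S⊆g i 1≤i i≤s x
  W⊆g i 1≤i i≤s (brW j 1≤j j<i xs)  = BrSpanW⊆g i j 1≤j j<i i≤s xs
  W⊆g i 1≤i i≤s zer                 = has-𝟎 (g-isSubspace i)
  W⊆g i 1≤i i≤s (add x y)           = has-⊕ (g-isSubspace i) (W⊆g i 1≤i i≤s x) (W⊆g i 1≤i i≤s y)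
  W⊆g i 1≤i i≤s (sca a x)           = has-· (g-isSubspace i) a (W⊆g i 1≤i i≤s x)
  BrSpanW⊆g i j 1≤j j<i i≤s (gen (mk x y)) =
    bracket-≤ (m≤n+m∸n i j) (W⊆g j 1≤j (≤-trans (<⇒≤ j<i) i≤s) x)
                            (W⊆g (i ∸ j) (m<n⇒0<n∸m j<i) (≤-trans (m∸n≤m i j) i≤s) y)
  BrSpanW⊆g i j 1≤j j<i i≤s zer       = has-𝟎 (g-isSubspace i)
  BrSpanW⊆g i j 1≤j j<i i≤s (add x y) = has-⊕ (g-isSubspace i) (BrSpanW⊆g i j 1≤j j<i i≤s x) (BrSpanW⊆g i j 1≤j j<i i≤s y)
  BrSpanW⊆g i j 1≤j j<i i≤s (sca a x) = has-· (g-isSubspace i) a (BrSpanW⊆g i j 1≤j j<i i≤s x)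

  T : ℕ → Sub
  T i = W S i +ˢ g (suc i)

  T-isSubspace : ∀ i → IsSubspace (T i)
  T-isSubspace i = +ˢ-isSubspace (W-isSubspace i) (g-isSubspace (suc i))

  g₊₁⊆T : ∀ i → g (suc i) ⊆ T i
  g₊₁⊆T i = +ˢ-inj₂ (W-isSubspace i)

  g⊆T-below : ℕ → Set
  g⊆T-below i = ∀ {k} → k < i → 1 ≤ k → g k ⊆ T k

  bracket∈T : ∀ {i j a b} → 1 ≤ j → j < i → i ≤ s → T j a → g (i ∸ j) b → T (i ∸ j) b → T i ⁅ a , b ⁆
  bracket∈T {i} {j} 1≤j j<i i≤s (w , r , Ww , gr , refl) gb (w' , r' , Ww' , gr' , refl) =
    ⁅ w , w' ⁆ , ⁅ w , r' ⁆ ⊕ ⁅ r , w' ⊕ r' ⁆ ,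
    brW j 1≤j j<i (gen (mk Ww Ww')) ,
    has-⊕ (g-isSubspace (suc i))
      (bracket-≤ (≤-trans (s≤s (m≤n+m∸n i j)) (≤-reflexive (sym (+-suc j (i ∸ j)))))
                 (W⊆g j 1≤j (≤-trans (<⇒≤ j<i) i≤s) Ww) gr')
      (bracket-≤ (s≤s (m≤n+m∸n i j)) gr gb) ,
    br-⊕-expand w r w' r'

  Brackets⊆T : ∀ {i} → i ≤ s → g⊆T-below i → ∀ j → j ≤ i → Brackets (g j) (g (i ∸ j)) ⊆ T i
  Brackets⊆T {i} i≤s ih zero _ (mk {a} x y) = g₊₁⊆T i (bracket 1 i (g1-all a) y)
  Brackets⊆T {i} i≤s ih (suc j) j≤i (mk {a} {b} x y) with suc j ≟ i
  ... | yes refl = g₊₁⊆T i (bracket-≤ (≤-reflexive (+-comm 1 i)) x (g1-all b))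
  ... | no  j≢i  =
    bracket∈T (s≤s z≤n) j<i i≤s (ih j<i (s≤s z≤n) x) y (ih (∸-monoʳ-< {o = 0} (s≤s z≤n) j≤i) (m<n⇒0<n∸m j<i) y)
    where
      j<i : suc j < i
      j<i = ≤∧≢⇒< j≤i j≢i

  𝔥⊆T : ∀ {i} → 1 ≤ i → i ≤ s → g⊆T-below i → 𝔥 g i ⊆ T i
  𝔥⊆T {i} 1≤i i≤s ih = GenLie-⊆-subspace (T-isSubspace i) (lieSub i) HGen⊆T (HGen⊆g i)
    (λ x y → g₊₁⊆T i (bracket-≤ (≤-trans (≤-reflexive (+-comm 1 i)) (+-monoʳ-≤ i 1≤i)) x y))
    where
      HGen⊆T : HGen g i ⊆ T i
      HGen⊆T (next x)       = g₊₁⊆T i x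
      HGen⊆T (brs j j≤i xs) = Span-least (T-isSubspace i) (Brackets⊆T i≤s ih j j≤i) xs

  g⊆T : (∀ i → 1 ≤ i → i ≤ s → SumIs (S i) (𝔥 g i) (g i)) → ∀ i → 1 ≤ i → i ≤ s → g i ⊆ T i
  g⊆T g≡S+𝔥 = <-rec (λ i → 1 ≤ i → i ≤ s → g i ⊆ T i) step
    where
      step : ∀ i → (∀ {k} → k < i → 1 ≤ k → k ≤ s → g k ⊆ T k) → 1 ≤ i → i ≤ s → g i ⊆ T i
      step i ih 1≤i i≤s {v} x with proj₁ (g≡S+𝔥 i 1≤i i≤s v) x
      ... | a , h , Sa , 𝔥h , refl =
        has-⊕ (T-isSubspace i) (+ˢ-inj₁ (g-isSubspace (suc i)) (fromS Sa)) (𝔥⊆T 1≤i i≤s ih′ 𝔥h)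
        where
          ih′ : g⊆T-below i
          ih′ k<i 1≤k = ih k<i 1≤k (≤-trans (<⇒≤ k<i) i≤s)

  W+g₊₁≡g : (∀ i → 1 ≤ i → i ≤ s → SumIs (S i) (𝔥 g i) (g i)) →
            ∀ i → 1 ≤ i → i ≤ s → SumIs (W S i) (g (suc i)) (g i)
  W+g₊₁≡g g≡S+𝔥 i 1≤i i≤s v =
    g⊆T g≡S+𝔥 i 1≤i i≤s , λ w r → has-⊕ (g-isSubspace i) (W⊆g i 1≤i i≤s w) (decr i r)

lemma3p5 : (R : CompleteOrderedField) (L : LieAlgebra R) →
    let open LieTheory L in
    FiniteDimensional → Nilpotent →
    (s : ℕ) (g : ℕ → Sub) → IsFiltration s g →
    (S : ℕ → Sub) →
    (∀ i → 1 ≤ i → i ≤ s → IsSubspace (S i) × S i ⊆ g i) →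
    (∀ i → 1 ≤ i → i ≤ s → SumIs (S i) (𝔥 g i) (g i)) →
    ∀ i → 1 ≤ i → i ≤ s → SumIs (W S i) (g (suc i)) (g i)
lemma3p5 R L _ _ s g F S S-sub g≡S+𝔥 =
  Complemented.W+g₊₁≡g L F (λ i 1≤i i≤s → proj₂ (S-sub i 1≤i i≤s)) g≡S+𝔥
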